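{- Let $X$ be a type variable, $O$ a type constant, $\alpha$ a variable, $A$ and $G$ types, and $G^o=O\rightarrow G\wedge O$. Then $\alpha:O\vdash_{\mathcal F}T_A:A[G/X]\rightarrow A[G^o/X]$ and $\alpha:O\vdash_{\mathcal F}T'_A:A[G^o/X]\rightarrow A[G/X]$.
   Context: System $\mathcal F$: types are built from type variables and type constants with $\rightarrow$ and $\forall$; typing $\Gamma\vdash_{\mathcal F}t:A$ of pure $\lambda$-terms by (ax), ($\rightarrow_i$): from $\Gamma,x:B\vdash t:C$ infer $\Gamma\vdash\lambda xt:B\rightarrow C$, ($\rightarrow_e$): from $\Gamma\vdash u:B\rightarrow C$, $\Gamma\vdash v:B$ infer $\Gamma\vdash(u)v:C$, ($\forall_i$): from $\Gamma\vdash t:A$, $X$ not free in $\Gamma$, infer $\Gamma\vdash t:\forall XA$, ($\forall_e$): from $\Gamma\vdash t:\forall XA$ infer $\Gamma\vdash t:A[C/X]$. $A\wedge B=\forall Z\{(A\rightarrow(B\rightarrow Z))\rightarrow Z\}$ ($Z$ fresh), and $\mathbf 1=\lambda x\lambda y\,x$. For each type $F$, $\lambda$-terms $T_F,T'_F$ are defined by induction on $F$ (relative to the fixed $X$ and $\alpha$): if $X$ is not free in $F$, $T_F=T'_F=\lambda x\,x$; if $F=X$, $T_F=\lambda x\lambda\beta\lambda g\,(g)x\alpha$ and $T'_F=\lambda x\,(x)\alpha\mathbf 1$; if $F=C\rightarrow D$, $T_F=\lambda x\lambda y\,(T_D)(x)(T'_C)y$ and $T'_F=\lambda x\lambda y\,(T'_D)(x)(T_C)y$;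 if $F=\forall YB$, $T_F=\lambda x\,(T_B)x$ and $T'_F=\lambda x\,(T'_B)x$. (Bound variables $x,y,\beta,g$ are distinct from $\alpha$.) -}

module Defs where

open import Data.Nat using (ℕ; zero; suc; _≡ᵇ_; _<ᵇ_; pred)
open import Data.Bool using (Bool; true; false; if_then_else_; _∨_)
open import Data.Product using (_×_; _,_)
open import Data.List using (List; []; _∷_; map)
open import Data.Maybe using (Maybe; just; nothing)
open import Relation.Binary.PropositionalEquality using (_≡_)

-- Types of system F.  Type variables are de Bruijn indices (tv n);
-- the index of a free variable is its "name" (shifted under binders).
-- Type constants are named by natural numbers (tc o).

data Ty : Set where
  tv   : ℕ → Ty
  tc   : ℕ → Ty
  _⇒_  : Ty → Ty → Ty
  ∀'   : Ty → Ty

infixr 6 _⇒_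

↑ : ℕ → Ty → Ty
↑ c (tv n) = if n <ᵇ c then tv n else tv (suc n)
↑ c (tc o) = tc o
↑ c (A ⇒ B) = ↑ c A ⇒ ↑ c B
↑ c (∀' A) = ∀' (↑ (suc c) A)

-- A [ C / X ] : capture-avoiding substitution of C for the free type
-- variable X (other free variables keep their names).
_[_/_] : Ty → Ty → ℕ → Ty
tv n [ C / k ] = if n ≡ᵇ k then C else tv n
tc o [ C / k ] = tc o
(A ⇒ B) [ C / k ] = (A [ C / k ]) ⇒ (B [ C / k ])
∀' A [ C / k ] = ∀' (A [ ↑ 0 C / suc k ])

-- instantiation of the bound variable (index k) of a ∀ by C;
-- used for the rule (∀e):  ∀X A  ↦  A[C/X]
inst : ℕ → Ty → Ty → Ty
inst k C (tv n) = if n <ᵇ k then tv n else (if n ≡ᵇ k then C else tv (pred n))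
inst k C (tc o) = tc o
inst k C (A ⇒ B) = inst k C A ⇒ inst k C B
inst k C (∀' A) = ∀' (inst (suc k) (↑ 0 C) A)

occ : ℕ → Ty → Bool
occ k (tv n) = n ≡ᵇ k
occ k (tc o) = false
occ k (A ⇒ B) = occ k A ∨ occ k B
occ k (∀' A) = occ (suc k) A

-- A ∧ B = ∀Z ((A → (B → Z)) → Z),  Z fresh
_∧_ : Ty → Ty → Ty
A ∧ B = ∀' ((↑ 0 A ⇒ (↑ 0 B ⇒ tv 0)) ⇒ tv 0)

Go : ℕ → Ty → Ty
Go o G = tc o ⇒ (G ∧ tc o)

data Tm : Set where
  var : ℕ → Tm
  lam : ℕ → Tm → Tm
  app : Tm → Tm → Tm

Ctx : Set
Ctx = List (ℕ × Ty)

lookup : Ctx → ℕ → Maybe Ty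
lookup [] x = nothing
lookup ((y , A) ∷ Γ) x = if x ≡ᵇ y then just A else lookup Γ x

-- shift all types of a context (so that index 0 is not free in it)
↑Γ : Ctx → Ctx
↑Γ = map (λ { (x , A) → (x , ↑ 0 A) })

infix 4 _⊢_∶_

data _⊢_∶_ : Ctx → Tm → Ty → Set where
  ax  : ∀ {Γ x A} → lookup Γ x ≡ just A → Γ ⊢ var x ∶ A
  →i  : ∀ {Γ x t B C} → ((x , B) ∷ Γ) ⊢ t ∶ C → Γ ⊢ lam x t ∶ B ⇒ C
  →e  : ∀ {Γ u v B C} → Γ ⊢ u ∶ B ⇒ C → Γ ⊢ v ∶ B → Γ ⊢ app u v ∶ C
  ∀i  : ∀ {Γ t A} → ↑Γ Γ ⊢ t ∶ A → Γ ⊢ t ∶ ∀' A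
  ∀e  : ∀ {Γ t A} (C : Ty) → Γ ⊢ t ∶ ∀' A → Γ ⊢ t ∶ inst 0 C A

-- The terms T_F, T'_F relative to the type variable X (index X) and
-- the term variable α.  Bound variables x,y,β,g are α+1,…,α+4
-- (distinct from α and from each other).

𝟏 : Tm
𝟏 = lam 0 (lam 1 (var 0))

idTm : Tm
idTm = lam 0 (var 0)

mutual
  T : ℕ → ℕ → Ty → Tm
  T X α F = if occ X F then Tocc X α F else idTm

  T' : ℕ → ℕ → Ty → Tm
  T' X α F = if occ X F then T'occ X α F else idTm

  Tocc : ℕ → ℕ → Ty → Tm
  Tocc X α (tv n) =
    lam (suc α) (lam (3 Data.Nat.+ α) (lam (4 Data.Nat.+ α)
      (app (app (var (4 Data.Nat.+ α)) (var (suc α))) (var α))))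
  Tocc X α (tc o) = idTm
  Tocc X α (C ⇒ D) =
    lam (suc α) (lam (2 Data.Nat.+ α)
      (app (T X α D) (app (var (suc α)) (app (T' X α C) (var (2 Data.Nat.+ α))))))
  Tocc X α (∀' B) = lam (suc α) (app (T (suc X) α B) (var (suc α)))

  T'occ : ℕ → ℕ → Ty → Tm
  T'occ X α (tv n) = lam (suc α) (app (app (var (suc α)) (var α)) 𝟏)
  T'occ X α (tc o) = idTm
  T'occ X α (C ⇒ D) =
    lam (suc α) (lam (2 Data.Nat.+ α)
      (app (T' X α D) (app (var (suc α)) (app (T X α C) (var (2 Data.Nat.+ α))))))
  T'occ X α (∀' B) = lam (suc α) (app (T' (suc X) α B) (var (suc α)))

module Submission where

-- The proof is by induction on A, with the context left arbitrary except
-- that it must declare α : O (the induction passes under λ- and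
-- ∀-binders).  Each clause of the definition of T_F, T'_F becomes one
-- lemma about a single direction of conversion:
--   * X not free in F: both substitutions agree, and λx x converts;
--   * F = X: λxλβλg (g)xα pairs a G with α into G^o, and (x)α𝟏 projects
--     it back, using that instantiating ∀Z at G gives back G;
--   * F = C → D: the conversion is contravariant in C, covariant in D;
--   * F = ∀Y B: conversions of B lift through ∀, by instantiating the
--     argument at the fresh variable and generalizing again.

open import Defs
open import Data.Nat using (ℕ; suc; pred; _+_; _≡ᵇ_; _<ᵇ_; _<_; _≤_; _<?_; z≤n; s≤s)
open import Data.Nat.Properties
  using (<ᵇ-reflects-<; <⇒<ᵇ; ≡⇒≡ᵇ; ≡ᵇ⇒≡; ≤⇒≯; ≮⇒≥; <⇒≤; <-cmp; <⇒≢; ≤-refl; n≤1+n; ≤-trans; <-≤-trans; m<n⇒m<1+n; m≢1+n+m)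
open import Data.Bool using (Bool; true; false; if_then_else_)
open import Data.Bool.Properties using (T-≡; ∨-conicalˡ; ∨-conicalʳ)
open import Data.Product using (_×_; _,_; proj₁; proj₂)
open import Data.List using ([]; _∷_)
open import Data.Maybe using (just)
open import Function using (_∘_; Equivalence)
open import Relation.Binary using (tri<; tri≈; tri>)
open import Relation.Binary.PropositionalEquality
open import Relation.Nullary using (contradiction; yes; no)
open import Relation.Nullary.Reflects using (ofʸ; fromEquivalence)

<ᵇ-true : ∀ {m n} → m < n → (m <ᵇ n) ≡ true
<ᵇ-true = Equivalence.to T-≡ ∘ <⇒<ᵇ

<ᵇ-false : ∀ {m n} → n ≤ m → (m <ᵇ n) ≡ false
<ᵇ-false {m} {n} n≤m with m <ᵇ n | <ᵇ-reflects-< m n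
... | false | _       = refl
... | true  | ofʸ m<n = contradiction m<n (≤⇒≯ n≤m)

≡ᵇ-refl : ∀ n → (n ≡ᵇ n) ≡ true
≡ᵇ-refl n = Equivalence.to T-≡ (≡⇒≡ᵇ n n refl)

≡ᵇ-false : ∀ {m n} → m ≢ n → (m ≡ᵇ n) ≡ false
≡ᵇ-false {m} {n} m≢n with m ≡ᵇ n | fromEquivalence {b = m ≡ᵇ n} (≡ᵇ⇒≡ m n) (≡⇒≡ᵇ m n)
... | false | _       = refl
... | true  | ofʸ m≡n = contradiction m≡n m≢n

↑-tv-< : ∀ {c n} → n < c → ↑ c (tv n) ≡ tv n
↑-tv-< n<c rewrite <ᵇ-true n<c = refl

↑-tv-≥ : ∀ {c n} → c ≤ n → ↑ c (tv n) ≡ tv (suc n)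
↑-tv-≥ c≤n rewrite <ᵇ-false c≤n = refl

inst-tv-< : ∀ {k C n} → n < k → inst k C (tv n) ≡ tv n
inst-tv-< n<k rewrite <ᵇ-true n<k = refl

inst-tv-≡ : ∀ {k C} → inst k C (tv k) ≡ C
inst-tv-≡ {k} rewrite <ᵇ-false (≤-refl {k}) | ≡ᵇ-refl k = refl

inst-tv-> : ∀ {k C n} → k < n → inst k C (tv n) ≡ tv (pred n)
inst-tv-> k<n rewrite <ᵇ-false (<⇒≤ k<n) | ≡ᵇ-false (≢-sym (<⇒≢ k<n)) = refl

-- Instantiating at level k a type weakened at level k forgets the
-- instance: ∀-elimination on a vacuous quantifier.
inst-↑ : ∀ k C A → inst k C (↑ k A) ≡ A
inst-↑ k C (tv n) with n <? k
... | yes n<k = trans (cong (inst k C) (↑-tv-< n<k)) (inst-tv-< n<k)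
... | no  n≮k = trans (cong (inst k C) (↑-tv-≥ (≮⇒≥ n≮k))) (inst-tv-> (s≤s (≮⇒≥ n≮k)))
inst-↑ k C (tc o)  = refl
inst-↑ k C (A ⇒ B) = cong₂ _⇒_ (inst-↑ k C A) (inst-↑ k C B)
inst-↑ k C (∀' A)  = cong ∀' (inst-↑ (suc k) (↑ 0 C) A)

-- Weakening above level k and then instantiating level k by the variable k
-- itself is the identity: eliminating ∀ at the fresh variable introduced
-- by weakening a context recovers the body.
inst-tv-↑ : ∀ k A → inst k (tv k) (↑ (suc k) A) ≡ A
inst-tv-↑ k (tv n) with <-cmp n k
... | tri< n<k _ _    = trans (cong (inst k (tv k)) (↑-tv-< (m<n⇒m<1+n n<k))) (inst-tv-< n<k)
... | tri≈ _ refl _   = trans (cong (inst k (tv k)) (↑-tv-< {suc k} {k} (s≤s ≤-refl))) (inst-tv-≡ {k})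
... | tri> _ _ k<n    = trans (cong (inst k (tv k)) (↑-tv-≥ k<n)) (inst-tv-> (m<n⇒m<1+n k<n))
inst-tv-↑ k (tc o)  = refl
inst-tv-↑ k (A ⇒ B) = cong₂ _⇒_ (inst-tv-↑ k A) (inst-tv-↑ k B)
inst-tv-↑ k (∀' A)  = cong ∀' (inst-tv-↑ (suc k) A)

↑-↑ : ∀ {c d} → c ≤ d → ∀ A → ↑ (suc d) (↑ c A) ≡ ↑ c (↑ d A)
↑-↑ {c} {d} c≤d (tv n) with n <? c | n <? d
... | yes n<c | _ = begin
  ↑ (suc d) (↑ c (tv n)) ≡⟨ cong (↑ (suc d)) (↑-tv-< n<c) ⟩
  ↑ (suc d) (tv n)       ≡⟨ ↑-tv-< (m<n⇒m<1+n (<-≤-trans n<c c≤d)) ⟩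
  tv n                   ≡⟨ sym (↑-tv-< n<c) ⟩
  ↑ c (tv n)             ≡⟨ cong (↑ c) (sym (↑-tv-< (<-≤-trans n<c c≤d))) ⟩
  ↑ c (↑ d (tv n))       ∎
  where open ≡-Reasoning
... | no n≮c | yes n<d = begin
  ↑ (suc d) (↑ c (tv n)) ≡⟨ cong (↑ (suc d)) (↑-tv-≥ (≮⇒≥ n≮c)) ⟩
  ↑ (suc d) (tv (suc n)) ≡⟨ ↑-tv-< (s≤s n<d) ⟩
  tv (suc n)             ≡⟨ sym (↑-tv-≥ (≮⇒≥ n≮c)) ⟩
  ↑ c (tv n)             ≡⟨ cong (↑ c) (sym (↑-tv-< n<d)) ⟩
  ↑ c (↑ d (tv n))       ∎
  where open ≡-Reasoning
... | no n≮c | no n≮d = begin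
  ↑ (suc d) (↑ c (tv n))  ≡⟨ cong (↑ (suc d)) (↑-tv-≥ (≮⇒≥ n≮c)) ⟩
  ↑ (suc d) (tv (suc n))  ≡⟨ ↑-tv-≥ (s≤s (≮⇒≥ n≮d)) ⟩
  tv (suc (suc n))        ≡⟨ sym (↑-tv-≥ (≤-trans (≮⇒≥ n≮c) (n≤1+n n))) ⟩
  ↑ c (tv (suc n))        ≡⟨ cong (↑ c) (sym (↑-tv-≥ (≮⇒≥ n≮d))) ⟩
  ↑ c (↑ d (tv n))        ∎
  where open ≡-Reasoning
↑-↑ c≤d (tc o)  = refl
↑-↑ c≤d (A ⇒ B) = cong₂ _⇒_ (↑-↑ c≤d A) (↑-↑ c≤d B)
↑-↑ c≤d (∀' A)  = cong ∀' (↑-↑ (s≤s c≤d) A)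

-- Shifting commutes with the encoded conjunction and hence with G ↦ G^o;
-- needed because T_{∀YB} works with G shifted under the binder Y.
↑-∧ : ∀ c A B → ↑ c (A ∧ B) ≡ ↑ c A ∧ ↑ c B
↑-∧ c A B = cong₂ (λ A′ B′ → ∀' ((A′ ⇒ (B′ ⇒ tv 0)) ⇒ tv 0)) (↑-↑ z≤n A) (↑-↑ z≤n B)

↑-Go : ∀ c o G → ↑ c (Go o G) ≡ Go o (↑ c G)
↑-Go c o G = cong (tc o ⇒_) (↑-∧ c G (tc o))

subst-unused : ∀ k C D A → occ k A ≡ false → A [ C / k ] ≡ A [ D / k ]
subst-unused k C D (tv n) n≢k rewrite n≢k = refl
subst-unused k C D (tc o) _ = refl
subst-unused k C D (A ⇒ B) absent =
  cong₂ _⇒_ (subst-unused k C D A (∨-conicalˡ (occ k A) (occ k B) absent))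
            (subst-unused k C D B (∨-conicalʳ (occ k A) (occ k B) absent))
subst-unused k C D (∀' A) absent = cong ∀' (subst-unused (suc k) (↑ 0 C) (↑ 0 D) A absent)

infix 4 _∋_∶_
data _∋_∶_ : Ctx → ℕ → Ty → Set where
  here  : ∀ {Γ x A} → (x , A) ∷ Γ ∋ x ∶ A
  there : ∀ {Γ x y A B} → x ≢ y → Γ ∋ x ∶ A → (y , B) ∷ Γ ∋ x ∶ A

var-typing : ∀ {Γ x A} → Γ ∋ x ∶ A → Γ ⊢ var x ∶ A
var-typing p = ax (lookup-≡ p)
  where
  lookup-≡ : ∀ {Γ x A} → Γ ∋ x ∶ A → lookup Γ x ≡ just A
  lookup-≡ {x = x} here rewrite ≡ᵇ-refl x = refl
  lookup-≡ (there x≢y p) rewrite ≡ᵇ-false x≢y = lookup-≡ p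

∋-↑Γ : ∀ {Γ x A} → Γ ∋ x ∶ A → ↑Γ Γ ∋ x ∶ ↑ 0 A
∋-↑Γ here          = here
∋-↑Γ (there x≢y p) = there x≢y (∋-↑Γ p)

id-typing : ∀ {Γ A} → Γ ⊢ idTm ∶ A ⇒ A
id-typing = →i (var-typing here)

𝟏-typing : ∀ {Γ A B} → Γ ⊢ 𝟏 ∶ A ⇒ B ⇒ A
𝟏-typing = →i (→i (var-typing (there (λ ()) here)))

-- Maps α o t A B: t converts A into B in every context declaring α : O.
-- The context must stay open since the induction passes under binders.
Maps : ℕ → ℕ → Tm → Ty → Ty → Set
Maps α o t A B = ∀ {Γ} → Γ ∋ α ∶ tc o → Γ ⊢ t ∶ A ⇒ B

Transfer : ℕ → ℕ → Tm → Tm → Ty → Ty → Set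
Transfer α o t t′ A B = Maps α o t A B × Maps α o t′ B A

identity-transfer : ∀ {α o A B} → A ≡ B → Transfer α o idTm idTm A B
identity-transfer refl = (λ _ → id-typing) , (λ _ → id-typing)

by-occurrence : ∀ {α o} X G F →
  (occ X F ≡ true → Transfer α o (Tocc X α F) (T'occ X α F) (F [ G / X ]) (F [ Go o G / X ])) →
  Transfer α o (T X α F) (T' X α F) (F [ G / X ]) (F [ Go o G / X ])
by-occurrence {α} {o} X G F occurs-transfer = cases (occ X F) refl
  where
  cases : (b : Bool) → occ X F ≡ b →
    Transfer α o (if b then Tocc X α F else idTm) (if b then T'occ X α F else idTm)
                 (F [ G / X ]) (F [ Go o G / X ])
  cases true  occurs = occurs-transfer occurs
  cases false absent = identity-transfer (subst-unused X G (Go o G) F absent)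

pair-map : ∀ {α o} X n G → Maps α o (Tocc X α (tv n)) G (Go o G)
pair-map {α} {o} X n G {Γ} α∶O =
  →i (→i (∀i (→i (→e (→e (var-typing here) (var-typing x∶G)) (var-typing α∶O′)))))
  where
  Γ′ Δ : Ctx
  Γ′ = (3 + α , tc o) ∷ (suc α , G) ∷ Γ
  Δ = (4 + α , ↑ 0 G ⇒ tc o ⇒ tv 0) ∷ ↑Γ Γ′
  x∶G : Δ ∋ suc α ∶ ↑ 0 G
  x∶G = there (m≢1+n+m (suc α) {2}) (there (m≢1+n+m (suc α) {1}) here)
  α∶O′ : Δ ∋ α ∶ tc o
  α∶O′ = there (m≢1+n+m α {3}) (∋-↑Γ {Γ′} (there (m≢1+n+m α {2}) (there (m≢1+n+m α {0}) α∶O)))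

project-map : ∀ {α o} X n G → Maps α o (T'occ X α (tv n)) (Go o G) G
project-map {α} {o} X n G {Γ} α∶O =
  →i (→e (subst (λ H → Δ ⊢ xα ∶ (H ⇒ (tc o ⇒ G)) ⇒ G) (inst-↑ 0 G G) (∀e G pair)) 𝟏-typing)
  where
  Δ : Ctx
  Δ = (suc α , Go o G) ∷ Γ
  xα : Tm
  xα = app (var (suc α)) (var α)
  pair : Δ ⊢ xα ∶ G ∧ tc o
  pair = →e (var-typing here) (var-typing (there (m≢1+n+m α {0}) α∶O))

var-transfer : ∀ {α o} X n G → (n ≡ᵇ X) ≡ true →
  Transfer α o (Tocc X α (tv n)) (T'occ X α (tv n)) (tv n [ G / X ]) (tv n [ Go o G / X ])
var-transfer X n G n≡X rewrite n≡X = pair-map X n G , project-map X n G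

arrow-map : ∀ {α o t u A A′ B B′} → Maps α o t A′ A → Maps α o u B B′ →
  Maps α o (lam (suc α) (lam (suc (suc α)) (app u (app (var (suc α)) (app t (var (suc (suc α)))))))) (A ⇒ B) (A′ ⇒ B′)
arrow-map {α} {o} {A = A} {A′} {B} t-map u-map {Γ} α∶O =
  →i (→i (→e (u-map α∶O′) (→e (var-typing x∶A⇒B) (→e (t-map α∶O′) (var-typing here)))))
  where
  Δ : Ctx
  Δ = (suc (suc α) , A′) ∷ (suc α , A ⇒ B) ∷ Γ
  x∶A⇒B : Δ ∋ suc α ∶ A ⇒ B
  x∶A⇒B = there (m≢1+n+m (suc α) {0}) here
  α∶O′ : Δ ∋ α ∶ tc o
  α∶O′ = there (m≢1+n+m α {1}) (there (m≢1+n+m α {0}) α∶O)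

arrow-transfer : ∀ {α o t t′ u u′ A A′ B B′} → Transfer α o t t′ A A′ → Transfer α o u u′ B B′ →
  Transfer α o (lam (suc α) (lam (suc (suc α)) (app u (app (var (suc α)) (app t′ (var (suc (suc α))))))))
               (lam (suc α) (lam (suc (suc α)) (app u′ (app (var (suc α)) (app t (var (suc (suc α))))))))
               (A ⇒ B) (A′ ⇒ B′)
arrow-transfer (t , t′) (u , u′) = arrow-map t′ u , arrow-map t u′

forall-map : ∀ {α o t A B} → Maps α o t A B → Maps α o (lam (suc α) (app t (var (suc α)))) (∀' A) (∀' B)
forall-map {α} {A = A} t-map {Γ} α∶O =
  →i (∀i (→e (t-map (∋-↑Γ {(suc α , ∀' A) ∷ Γ} (there (m≢1+n+m α {0}) α∶O)))
             (subst (Δ ⊢ var (suc α) ∶_) (inst-tv-↑ 0 A) (∀e (tv 0) (var-typing here)))))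
  where
  Δ : Ctx
  Δ = ↑Γ ((suc α , ∀' A) ∷ Γ)

forall-transfer : ∀ {α o t t′ A B} → Transfer α o t t′ A B →
  Transfer α o (lam (suc α) (app t (var (suc α)))) (lam (suc α) (app t′ (var (suc α)))) (∀' A) (∀' B)
forall-transfer (t , t′) = forall-map t , forall-map t′

-- Under ∀Y the induction hypothesis is used with G shifted, where
-- (∀YB)[G^o/X] involves the shift of G^o, i.e. (shifted G)^o.
transfer : ∀ {α o} F X G → Transfer α o (T X α F) (T' X α F) (F [ G / X ]) (F [ Go o G / X ])
transfer (tv n)  X G = by-occurrence X G (tv n) (var-transfer X n G)
transfer (tc c)  X G = by-occurrence X G (tc c) λ ()
transfer (C ⇒ D) X G = by-occurrence X G (C ⇒ D) λ _ → arrow-transfer (transfer C X G) (transfer D X G)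
transfer {α} {o} (∀' B) X G = by-occurrence X G (∀' B) λ _ → forall-transfer
  (subst (λ H → Transfer α o (T (suc X) α B) (T' (suc X) α B) (B [ ↑ 0 G / suc X ]) (B [ H / suc X ]))
         (sym (↑-Go 0 o G)) (transfer B (suc X) (↑ 0 G)))

lemma3p1 : (X o α : ℕ) (A G : Ty) →
    (((α , tc o) ∷ []) ⊢ T X α A ∶ (A [ G / X ] ⇒ A [ Go o G / X ]))
    × (((α , tc o) ∷ []) ⊢ T' X α A ∶ (A [ Go o G / X ] ⇒ A [ G / X ]))
lemma3p1 X o α A G = proj₁ (transfer A X G) here , proj₂ (transfer A X G) here
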